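{- Let $n\ge 3$ and let $G$ be the path $P_n$ or the cycle $C_n$. Then $\gamma_{LD}(M(G)) \geq \left\lceil \frac{2n}{5}\right\rceil + 1$.
   Context: All graphs are finite, simple and connected. For a graph $G=(V,E)$ and $x\in V$, $N(x)$ is the open neighbourhood and $N[x]=N(x)\cup\{x\}$. A set $C\subseteq V$ is a locating-dominating set ($LD$-set) if $N[x]\cap C\neq\emptyset$ for all $x\in V$ and $N(x)\cap C\neq N(y)\cap C$ for all distinct $x,y\in V\setminus C$; $\gamma_{LD}(G)$ is the minimum size of an $LD$-set. $P_n$ is the path and $C_n$ the cycle on $n$ vertices. The Mycielski graph $M(G)$ of $G$ with $V=\{v_1,\dots,v_n\}$ is obtained from $G$ by adding, for each $i$, a new vertex $u_i$ adjacent to every vertex of $N_G(v_i)$, and then adding one further vertex $u$ adjacent to all of $u_1,\dots,u_n$ (and to nothing else). -}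

module Defs where

open import Data.Nat using (ℕ; zero; suc; _+_; _*_; _≤_)
open import Data.Nat.DivMod using (_/_)
open import Data.Fin using (Fin; toℕ)
open import Data.List using (List; []; _∷_; _++_; map; allFin)
open import Data.Nat.ListAction using (sum)
open import Data.Bool using (Bool; true; false; if_then_else_)
open import Data.Product using (_×_; ∃)
open import Data.Sum using (_⊎_)
open import Data.Unit using (⊤)
open import Data.Empty using (⊥)
open import Relation.Binary.PropositionalEquality using (_≡_; _≢_)
open import Relation.Nullary using (¬_)
open import Function.Bundles using (_⇔_)

PathAdj : (n : ℕ) → Fin n → Fin n → Set
PathAdj n i j = (suc (toℕ i) ≡ toℕ j) ⊎ (suc (toℕ j) ≡ toℕ i)

CycleAdj : (n : ℕ) → Fin n → Fin n → Set
CycleAdj n i j = PathAdj n i j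
               ⊎ ((toℕ i ≡ 0 × suc (toℕ j) ≡ n) ⊎ (toℕ j ≡ 0 × suc (toℕ i) ≡ n))

data Kind : Set where
  path cycle : Kind

BaseAdj : Kind → (n : ℕ) → Fin n → Fin n → Set
BaseAdj path  n = PathAdj n
BaseAdj cycle n = CycleAdj n

-- Vertices of the Mycielski graph M(G): v i (original), u i (shadow), w (the extra vertex u).
data MV (n : ℕ) : Set where
  v : Fin n → MV n
  u : Fin n → MV n
  w : MV n

MAdj : {n : ℕ} → (Fin n → Fin n → Set) → MV n → MV n → Set
MAdj A (v i) (v j) = A i j
MAdj A (v i) (u j) = A j i    -- u_j is adjacent to N_G(v_j)
MAdj A (u i) (v j) = A i j
MAdj A (u i) (u j) = ⊥
MAdj A (u i) w     = ⊤
MAdj A w     (u j) = ⊤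
MAdj A (v i) w     = ⊥
MAdj A w     (v j) = ⊥
MAdj A w     w     = ⊥

MVerts : (n : ℕ) → List (MV n)
MVerts n = map v (allFin n) ++ map u (allFin n) ++ (w ∷ [])

_∈C_ : {V : Set} → V → (V → Bool) → Set
x ∈C C = C x ≡ true

IsLDSet : {V : Set} → (V → V → Set) → (V → Bool) → Set
IsLDSet {V} Adj C =
  ((x : V) → ∃ λ y → ((y ≡ x) ⊎ Adj x y) × (y ∈C C))
  × ((x y : V) → x ≢ y → ¬ (x ∈C C) → ¬ (y ∈C C) →
       ¬ ((z : V) → z ∈C C → (Adj x z ⇔ Adj y z)))

card : {n : ℕ} → (MV n → Bool) → ℕ
card {n} C = sum (map (λ x → if C x then 1 else 0) (MVerts n))

ceil5 : ℕ → ℕ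
ceil5 m = (m + 4) / 5

{-# OPTIONS --safe #-}
module Submission where

-- Discharging.  Let C be an LD-set and R any set of vertices.  Each x ∈ R ∖ C has a
-- C-neighbour; let it send 2 to its C-neighbour if that is unique, and 1 to each
-- C-neighbour otherwise, so it sends at least 2.  Two vertices outside C with the same
-- unique C-neighbour c would have the same trace on C, so c ∈ C receives at most
-- d + min d 1, where d is its number of neighbours in R ∖ C.  Hence
-- 2 |R ∖ C| ≤ Σ_{c ∈ C} (d c + min (d c) 1).
-- In M(G) with G of maximum degree 2, let a and b count the v_i and u_i in C.  If u ∈ C,
-- take R = {v_i}: every vertex of C receives at most 3, so 2 (n − a) ≤ 3 a + 3 b.
-- If u ∉ C, take R = V: v_i receives at most 5 and u_i at most 4, so
-- 2 (2n − a − b + 1) ≤ 5 a + 4 b, while b ≥ 1 because u is dominated.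

open import Defs
open import Data.Nat using (ℕ; zero; suc; _+_; _*_; _∸_; _⊓_; _≤_; _<_; z≤n; s≤s; _≡ᵇ_)
open import Data.Nat.Properties
open import Data.Nat.DivMod using (m<n*o⇒m/o<n)
open import Data.Nat.ListAction using (sum)
open import Data.Nat.ListAction.Properties using (sum-++)
open import Data.Nat.Tactic.RingSolver using (solve-∀)
open import Data.Bool using (Bool; true; false; if_then_else_; _∧_; not; T)
open import Data.Bool.Properties using (T-≡)
open import Data.Fin using (Fin; toℕ)
open import Data.Fin.Properties using (toℕ-injective; toℕ<n)
open import Data.List using (List; []; _∷_; _++_; map; allFin; length)
open import Data.List.Properties using (map-++; map-∘; length-tabulate)
open import Data.List.Membership.Propositional using (_∈_)
open import Data.List.Membership.Propositional.Properties using (∈-map⁺; ∈-map⁻; ∈-++⁺ˡ; ∈-++⁺ʳ; ∈-++⁻; ∈-allFin)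
open import Data.List.Relation.Unary.Any using (here; there)
open import Data.List.Relation.Unary.All as All using (All; []; _∷_)
open import Data.List.Relation.Unary.AllPairs using ([]; _∷_)
open import Data.List.Relation.Unary.Unique.Propositional using (Unique)
open import Data.List.Relation.Unary.Unique.Propositional.Properties using (map⁺; ++⁺; allFin⁺)
open import Data.Product using (_×_; _,_; proj₁; proj₂)
open import Data.Sum using (_⊎_; inj₁; inj₂)
open import Data.Empty using (⊥; ⊥-elim)
open import Data.Unit using (tt)
open import Function.Base using (id)
open import Function.Bundles using (mk⇔; Equivalence)
open import Relation.Binary.Definitions using (Decidable; Symmetric)
open import Relation.Binary.PropositionalEquality
open import Relation.Nullary using (Dec; yes; no; ¬_; contradiction)
open import Relation.Nullary.Decidable using (⌊_⌋; fromWitness; toWitness; _⊎-dec_; _×-dec_)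

𝟙 : Bool → ℕ
𝟙 b = if b then 1 else 0

𝟙≤1 : ∀ b → 𝟙 b ≤ 1
𝟙≤1 true  = ≤-refl
𝟙≤1 false = z≤n

1≤𝟙 : ∀ {b} → T b → 1 ≤ 𝟙 b
1≤𝟙 {true} _ = ≤-refl

1≤𝟙ᵗ : ∀ {b} → b ≡ true → 1 ≤ 𝟙 b
1≤𝟙ᵗ refl = ≤-refl

1≤𝟙⁻ : ∀ {b} → 1 ≤ 𝟙 b → T b
1≤𝟙⁻ {true} _ = tt

𝟙*≤ : ∀ b m → 𝟙 b * m ≤ m
𝟙*≤ true  m = ≤-reflexive (+-identityʳ m)
𝟙*≤ false m = z≤n

𝟙⌊⌋-mono : ∀ {P Q : Set} (p? : Dec P) (q? : Dec Q) → (P → Q) → 𝟙 ⌊ p? ⌋ ≤ 𝟙 ⌊ q? ⌋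
𝟙⌊⌋-mono p? q? P⇒Q with p?
... | yes p = 1≤𝟙 (fromWitness (P⇒Q p))
... | no  _ = z≤n

*-pos⁻ : ∀ m n → 1 ≤ m * n → 1 ≤ m × 1 ≤ n
*-pos⁻ (suc m) (suc n) _ = s≤s z≤n , s≤s z≤n
*-pos⁻ (suc m) zero   p = contradiction (≤-trans p (≤-reflexive (*-zeroʳ m))) λ ()

∑ : {X : Set} → List X → (X → ℕ) → ℕ
∑ L f = sum (map f L)

∑-syntax : {X : Set} → List X → (X → ℕ) → ℕ
∑-syntax = ∑

infix 5 ∑-syntax
syntax ∑-syntax L (λ x → e) = ∑[ x ∈ L ] e

module _ {X : Set} where

  ∑-cong : (L : List X) {f g : X → ℕ} → (∀ x → f x ≡ g x) → ∑ L f ≡ ∑ L g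
  ∑-cong []      f≡g = refl
  ∑-cong (x ∷ L) f≡g = cong₂ _+_ (f≡g x) (∑-cong L f≡g)

  ∑-mono : (L : List X) {f g : X → ℕ} → (∀ x → f x ≤ g x) → ∑ L f ≤ ∑ L g
  ∑-mono []      f≤g = z≤n
  ∑-mono (x ∷ L) f≤g = +-mono-≤ (f≤g x) (∑-mono L f≤g)

  ∑-zero : (L : List X) → ∑[ x ∈ L ] 0 ≡ 0
  ∑-zero []      = refl
  ∑-zero (x ∷ L) = ∑-zero L

  ∑-++ : (L M : List X) (f : X → ℕ) → ∑ (L ++ M) f ≡ ∑ L f + ∑ M f
  ∑-++ L M f = trans (cong sum (map-++ f L M)) (sum-++ (map f L) (map f M))

  ∑-+ : (L : List X) (f g : X → ℕ) → ∑[ x ∈ L ] (f x + g x) ≡ ∑ L f + ∑ L g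
  ∑-+ []      f g = refl
  ∑-+ (x ∷ L) f g = trans (cong (f x + g x +_) (∑-+ L f g)) (interchange (f x) (g x) _ _)
    where
    interchange : ∀ a b c d → a + b + (c + d) ≡ a + c + (b + d)
    interchange = solve-∀

  ∑-*ˡ : (L : List X) (k : ℕ) (f : X → ℕ) → ∑[ x ∈ L ] k * f x ≡ k * ∑ L f
  ∑-*ˡ []      k f = sym (*-zeroʳ k)
  ∑-*ˡ (x ∷ L) k f = trans (cong (k * f x +_) (∑-*ˡ L k f)) (sym (*-distribˡ-+ k (f x) _))

  ∑-*ʳ : (L : List X) (k : ℕ) (f : X → ℕ) → ∑[ x ∈ L ] f x * k ≡ ∑ L f * k
  ∑-*ʳ []      k f = refl
  ∑-*ʳ (x ∷ L) k f = trans (cong (f x * k +_) (∑-*ʳ L k f)) (sym (*-distribʳ-+ k (f x) _))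

  ∑-comm : (L M : List X) (h : X → X → ℕ) →
           ∑[ x ∈ L ] ∑[ y ∈ M ] h x y ≡ ∑[ y ∈ M ] ∑[ x ∈ L ] h x y
  ∑-comm []      M h = sym (∑-zero M)
  ∑-comm (x ∷ L) M h = trans (cong (∑ M (h x) +_) (∑-comm L M h)) (sym (∑-+ M (h x) _))

  ∑-≥ : (L : List X) (f : X → ℕ) {x : X} → x ∈ L → f x ≤ ∑ L f
  ∑-≥ (y ∷ L) f (here refl) = m≤m+n (f y) (∑ L f)
  ∑-≥ (y ∷ L) f (there x∈L) = ≤-trans (∑-≥ L f x∈L) (m≤n+m (∑ L f) (f y))

  ∑-≥-pair : (L : List X) → Unique L → (f : X → ℕ) {x y : X} →
             x ∈ L → y ∈ L → x ≢ y → f x + f y ≤ ∑ L f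
  ∑-≥-pair (z ∷ L) _ f (here refl) (here refl) x≢y = contradiction refl x≢y
  ∑-≥-pair (z ∷ L) _ f (here refl) (there y∈L) _ = +-monoʳ-≤ (f z) (∑-≥ L f y∈L)
  ∑-≥-pair (z ∷ L) _ f {x} (there x∈L) (here refl) _ =
    ≤-trans (≤-reflexive (+-comm (f x) (f z))) (+-monoʳ-≤ (f z) (∑-≥ L f x∈L))
  ∑-≥-pair (z ∷ L) (_ ∷ L-unique) f (there x∈L) (there y∈L) x≢y =
    ≤-trans (∑-≥-pair L L-unique f x∈L y∈L x≢y) (m≤n+m (∑ L f) (f z))

  ∑-vanishing : (L : List X) {f : X → ℕ} → All (λ x → f x ≡ 0) L → ∑ L f ≡ 0
  ∑-vanishing []      []          = refl
  ∑-vanishing (x ∷ L) (fx≡0 ∷ f≡0) = cong₂ _+_ fx≡0 (∑-vanishing L f≡0)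

  ∑-≤1 : (L : List X) → Unique L → {f : X → ℕ} → (∀ x → f x ≤ 1) →
         (∀ {x y} → x ≢ y → 1 ≤ f x → 1 ≤ f y → ⊥) → ∑ L f ≤ 1
  ∑-≤1 []      _              f≤1 no-two = z≤n
  ∑-≤1 (x ∷ L) (x∉L ∷ L-unique) {f} f≤1 no-two with 1 ≤? f x
  ... | no  fx≱1 = subst (λ m → m + ∑ L f ≤ 1) (sym (vanish fx≱1)) (∑-≤1 L L-unique f≤1 no-two)
    where
    vanish : ∀ {y} → ¬ 1 ≤ f y → f y ≡ 0
    vanish fy≱1 = n<1⇒n≡0 (≰⇒> fy≱1)
  ... | yes fx≥1 = subst (λ m → f x + m ≤ 1) (sym (∑-vanishing L (All.map vanish x∉L)))
                         (≤-trans (≤-reflexive (+-identityʳ (f x))) (f≤1 x))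
    where
    vanish : ∀ {y} → x ≢ y → f y ≡ 0
    vanish x≢y = n<1⇒n≡0 (≰⇒> (no-two x≢y fx≥1))

  ∑-complement : (L : List X) (g : X → Bool) →
                 (∑[ x ∈ L ] 𝟙 (not (g x))) + (∑[ x ∈ L ] 𝟙 (g x)) ≡ length L
  ∑-complement L g = trans (sym (∑-+ L _ _)) (each-once L)
    where
    each-once : (L : List X) → ∑[ x ∈ L ] (𝟙 (not (g x)) + 𝟙 (g x)) ≡ length L
    each-once []      = refl
    each-once (x ∷ L) = cong₂ _+_ (one (g x)) (each-once L)
      where
      one : ∀ b → 𝟙 (not b) + 𝟙 b ≡ 1
      one true  = refl
      one false = refl

∑-map : {X Y : Set} (g : X → Y) (L : List X) (f : Y → ℕ) → ∑ (map g L) f ≡ ∑[ x ∈ L ] f (g x)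
∑-map g L f = cong sum (sym (map-∘ L))

weight-bound : ∀ t → 1 ≤ t → 2 ≤ suc (𝟙 ⌊ t ≟ 1 ⌋) * t
weight-bound (suc zero)    _ = ≤-refl
weight-bound (suc (suc t)) _ = ≤-trans (s≤s (s≤s z≤n)) (m≤m+n (suc (suc t)) _)

∉-of-∧-not : ∀ {r b} → r ∧ not b ≡ true → ¬ b ≡ true
∉-of-∧-not {true}  {false} _ ()
∉-of-∧-not {true}  {true}  ()
∉-of-∧-not {false}         ()

module Discharging
  {X : Set} (L : List X) (L-unique : Unique L) (L-complete : ∀ x → x ∈ L)
  {Adj : X → X → Set} (adj? : Decidable Adj) {C : X → Bool} (isLD : IsLDSet Adj C)
  (R : X → Bool)
  where

  adj : X → X → ℕ
  adj x c = 𝟙 ⌊ adj? x c ⌋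

  trace : X → ℕ
  trace x = ∑[ c ∈ L ] 𝟙 (C c) * adj x c

  outside : X → ℕ
  outside x = 𝟙 (R x ∧ not (C x))

  weight : X → ℕ
  weight x = suc (𝟙 ⌊ trace x ≟ 1 ⌋)

  load : X → ℕ
  load c = ∑[ x ∈ L ] outside x * adj x c

  sole : X → ℕ
  sole c = ∑[ x ∈ L ] 𝟙 ⌊ trace x ≟ 1 ⌋ * (outside x * adj x c)

  linked-pos : ∀ {x c} → c ∈C C → Adj x c → 1 ≤ 𝟙 (C c) * adj x c
  linked-pos {x} {c} c∈C x~c =
    *-mono-≤ (1≤𝟙ᵗ c∈C) (1≤𝟙 (fromWitness {a? = adj? x c} x~c))

  trace-pos : ∀ {x} → ¬ x ∈C C → 1 ≤ trace x
  trace-pos {x} x∉C with proj₁ isLD x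
  ... | y , inj₁ refl , y∈C = contradiction y∈C x∉C
  ... | y , inj₂ x~y  , y∈C =
    ≤-trans (linked-pos y∈C x~y) (∑-≥ L (λ c → 𝟙 (C c) * adj x c) (L-complete y))

  trace-one : ∀ {x c z} → trace x ≡ 1 → c ∈C C → Adj x c → z ∈C C → Adj x z → z ≢ c → ⊥
  trace-one {x} t≡1 c∈C x~c z∈C x~z z≢c = <-irrefl refl (begin
    2        ≤⟨ +-mono-≤ (linked-pos z∈C x~z) (linked-pos c∈C x~c) ⟩
    _        ≤⟨ ∑-≥-pair L L-unique (λ c → 𝟙 (C c) * adj x c) (L-complete _) (L-complete _) z≢c ⟩
    trace x  ≡⟨ t≡1 ⟩
    1        ∎)
    where open ≤-Reasoning

  sole-summand-pos : ∀ {x c} → 1 ≤ 𝟙 ⌊ trace x ≟ 1 ⌋ * (outside x * adj x c) →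
                     ¬ x ∈C C × Adj x c × trace x ≡ 1
  sole-summand-pos {x} {c} pos with *-pos⁻ (𝟙 ⌊ trace x ≟ 1 ⌋) (outside x * adj x c) pos
  ... | t≡1 , pos′ with *-pos⁻ (outside x) (adj x c) pos′
  ... | x∉C , x~c =
    ∉-of-∧-not (Equivalence.to T-≡ (1≤𝟙⁻ x∉C)) ,
    toWitness {a? = adj? x c} (1≤𝟙⁻ x~c) ,
    toWitness {a? = trace x ≟ 1} (1≤𝟙⁻ t≡1)

  sole≤1 : ∀ {c} → c ∈C C → sole c ≤ 1
  sole≤1 {c} c∈C = ∑-≤1 L L-unique summand≤1 no-two
    where
    summand≤1 : ∀ x → 𝟙 ⌊ trace x ≟ 1 ⌋ * (outside x * adj x c) ≤ 1
    summand≤1 x =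
      *-mono-≤ (𝟙≤1 ⌊ trace x ≟ 1 ⌋) (*-mono-≤ (𝟙≤1 (R x ∧ not (C x))) (𝟙≤1 ⌊ adj? x c ⌋))

    transfer : ∀ {x y z} → trace x ≡ 1 → Adj x c → Adj y c → z ∈C C → Adj x z → Adj y z
    transfer {y = y} {z} t≡1 x~c y~c z∈C x~z with adj? y z
    ... | yes y~z = y~z
    ... | no  y≁z = ⊥-elim (trace-one t≡1 c∈C x~c z∈C x~z λ { refl → y≁z y~c })

    no-two : ∀ {x y} → x ≢ y → 1 ≤ 𝟙 ⌊ trace x ≟ 1 ⌋ * (outside x * adj x c) →
             1 ≤ 𝟙 ⌊ trace y ≟ 1 ⌋ * (outside y * adj y c) → ⊥
    no-two {x} {y} x≢y px py with sole-summand-pos px | sole-summand-pos py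
    ... | x∉C , x~c , tx | y∉C , y~c , ty =
      proj₂ isLD x y x≢y x∉C y∉C λ z z∈C →
        mk⇔ (transfer tx x~c y~c z∈C) (transfer ty y~c x~c z∈C)

  sole≤load : ∀ c → sole c ≤ load c
  sole≤load c = ∑-mono L λ x → 𝟙*≤ ⌊ trace x ≟ 1 ⌋ (outside x * adj x c)

  sent≥2 : ∀ x → 2 * outside x ≤ outside x * (weight x * trace x)
  sent≥2 x with R x ∧ not (C x) in x∈R∖C
  ... | false = z≤n
  ... | true  = ≤-trans (weight-bound (trace x) (trace-pos (∉-of-∧-not x∈R∖C)))
                        (≤-reflexive (sym (+-identityʳ _)))

  double-count : 2 * ∑ L outside ≤ ∑[ c ∈ L ] 𝟙 (C c) * (load c + sole c)
  double-count = begin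
    2 * ∑ L outside
      ≡⟨ ∑-*ˡ L 2 outside ⟨
    ∑[ x ∈ L ] 2 * outside x
      ≤⟨ ∑-mono L sent≥2 ⟩
    ∑[ x ∈ L ] outside x * (weight x * trace x)
      ≡⟨ ∑-cong L (λ x → trans (∑-*ˡ L (outside x) _) (cong (outside x *_) (∑-*ˡ L (weight x) _))) ⟨
    ∑[ x ∈ L ] ∑[ c ∈ L ] outside x * (weight x * (𝟙 (C c) * adj x c))
      ≡⟨ ∑-comm L L _ ⟩
    ∑[ c ∈ L ] ∑[ x ∈ L ] outside x * (weight x * (𝟙 (C c) * adj x c))
      ≡⟨ ∑-cong L (λ c → trans (∑-cong L λ x → regroup (outside x) (weight x) (𝟙 (C c)) (adj x c))
                               (∑-*ˡ L (𝟙 (C c)) _)) ⟩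
    ∑[ c ∈ L ] 𝟙 (C c) * (∑[ x ∈ L ] weight x * (outside x * adj x c))
      ≡⟨ ∑-cong L (λ c → cong (𝟙 (C c) *_) (∑-+ L _ _)) ⟩   -- weight x * m reduces to m + _ * m
    ∑[ c ∈ L ] 𝟙 (C c) * (load c + sole c) ∎
    where
    open ≤-Reasoning
    regroup : ∀ o w k a → o * (w * (k * a)) ≡ k * (w * (o * a))
    regroup = solve-∀

  discharging : (B : X → ℕ) → (∀ c → c ∈C C → load c ≤ B c) →
                2 * ∑ L outside ≤ ∑[ c ∈ L ] 𝟙 (C c) * (B c + B c ⊓ 1)
  discharging B load≤B = ≤-trans double-count (∑-mono L received≤budget)
    where
    received≤budget : ∀ c → 𝟙 (C c) * (load c + sole c) ≤ 𝟙 (C c) * (B c + B c ⊓ 1)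
    received≤budget c with C c in c∈C
    ... | false = z≤n
    ... | true  = *-monoʳ-≤ 1 (+-mono-≤ (load≤B c c∈C)
                    (⊓-glb (≤-trans (sole≤load c) (load≤B c c∈C)) (sole≤1 c∈C)))

  load≤ : ∀ c → load c ≤ ∑[ x ∈ L ] (if R x then adj x c else 0)
  load≤ c = ∑-mono L λ x → restrict (R x) (C x) (adj x c)
    where
    restrict : ∀ r b a → 𝟙 (r ∧ not b) * a ≤ (if r then a else 0)
    restrict true  b a = 𝟙*≤ (not b) a
    restrict false b a = z≤n

MAdj? : ∀ {n} {A : Fin n → Fin n → Set} → Decidable A → Decidable (MAdj A)
MAdj? A? (v i) (v j) = A? i j
MAdj? A? (v i) (u j) = A? j i
MAdj? A? (u i) (v j) = A? i j
MAdj? A? (u i) (u j) = no λ ()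
MAdj? A? (u i) w     = yes tt
MAdj? A? w     (u j) = yes tt
MAdj? A? (v i) w     = no λ ()
MAdj? A? w     (v j) = no λ ()
MAdj? A? w     w     = no λ ()

MVerts-unique : ∀ n → Unique (MVerts n)
MVerts-unique n =
  ++⁺ (map⁺ v-injective (allFin⁺ n)) (++⁺ (map⁺ u-injective (allFin⁺ n)) ([] ∷ []) u-disjoint) v-disjoint
  where
  v-injective : ∀ {i j : Fin n} → v i ≡ v j → i ≡ j
  v-injective refl = refl
  u-injective : ∀ {i j : Fin n} → u i ≡ u j → i ≡ j
  u-injective refl = refl
  u-disjoint : ∀ {x} → ¬ (x ∈ map u (allFin n) × x ∈ w ∷ [])
  u-disjoint (x∈us , here refl) with ∈-map⁻ u x∈us
  ... | _ , _ , ()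
  v-disjoint : ∀ {x} → ¬ (x ∈ map v (allFin n) × x ∈ map u (allFin n) ++ w ∷ [])
  v-disjoint (x∈vs , x∈rest) with ∈-map⁻ v x∈vs
  ... | i , _ , refl with ∈-++⁻ (map u (allFin n)) x∈rest
  ...   | inj₁ x∈us with ∈-map⁻ u x∈us
  ...     | _ , _ , ()
  v-disjoint (x∈vs , x∈rest) | i , _ , refl | inj₂ (here ())

MVerts-complete : ∀ n (x : MV n) → x ∈ MVerts n
MVerts-complete n (v i) = ∈-++⁺ˡ (∈-map⁺ v (∈-allFin i))
MVerts-complete n (u i) = ∈-++⁺ʳ (map v (allFin n)) (∈-++⁺ˡ (∈-map⁺ u (∈-allFin i)))
MVerts-complete n w     = ∈-++⁺ʳ (map v (allFin n)) (∈-++⁺ʳ (map u (allFin n)) (here refl))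

∑-MVerts : ∀ {n} (f : MV n → ℕ) →
           ∑ (MVerts n) f ≡ (∑[ i ∈ allFin n ] f (v i)) + (∑[ i ∈ allFin n ] f (u i)) + f w
∑-MVerts {n} f = begin
  ∑ (map v (allFin n) ++ map u (allFin n) ++ w ∷ []) f
    ≡⟨ ∑-++ (map v (allFin n)) _ f ⟩
  ∑ (map v (allFin n)) f + ∑ (map u (allFin n) ++ w ∷ []) f
    ≡⟨ cong (∑ (map v (allFin n)) f +_) (∑-++ (map u (allFin n)) _ f) ⟩
  ∑ (map v (allFin n)) f + (∑ (map u (allFin n)) f + (f w + 0))
    ≡⟨ cong₂ (λ p q → p + (q + (f w + 0))) (∑-map v (allFin n) f) (∑-map u (allFin n) f) ⟩
  (∑[ i ∈ allFin n ] f (v i)) + ((∑[ i ∈ allFin n ] f (u i)) + (f w + 0))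
    ≡⟨ reassociate (∑[ i ∈ allFin n ] f (v i)) (∑[ i ∈ allFin n ] f (u i)) (f w) ⟩
  (∑[ i ∈ allFin n ] f (v i)) + (∑[ i ∈ allFin n ] f (u i)) + f w ∎
  where
  open ≡-Reasoning
  reassociate : ∀ p q r → p + (q + (r + 0)) ≡ p + q + r
  reassociate = solve-∀

ceil5-bound : ∀ m s → m + 5 ≤ s * 5 → ceil5 m + 1 ≤ s
ceil5-bound m s m+5≤5s =
  ≤-trans (≤-reflexive (+-comm (ceil5 m) 1))
          (m<n*o⇒m/o<n (≤-trans (≤-reflexive (sym (+-suc m 4))) m+5≤5s))

ceil5-2n≤a+b : ∀ {n a b a′} → a′ + a ≡ n → 2 * a′ ≤ a * 3 + b * 3 →
               ceil5 (2 * n) + 1 ≤ a + b + 1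
ceil5-2n≤a+b {n} {a} {b} {a′} a′+a≡n 2a′≤3a+3b = ceil5-bound (2 * n) (a + b + 1) (begin
  2 * n + 5                          ≡⟨ cong (λ m → 2 * m + 5) a′+a≡n ⟨
  2 * (a′ + a) + 5                   ≡⟨ expand a′ a ⟩
  2 * a′ + (2 * a + 5)               ≤⟨ +-monoˡ-≤ (2 * a + 5) 2a′≤3a+3b ⟩
  a * 3 + b * 3 + (2 * a + 5)        ≤⟨ m≤m+n _ (2 * b) ⟩
  a * 3 + b * 3 + (2 * a + 5) + 2 * b ≡⟨ collect a b ⟩
  (a + b + 1) * 5                    ∎)
  where
  open ≤-Reasoning
  expand : ∀ a′ a → 2 * (a′ + a) + 5 ≡ 2 * a′ + (2 * a + 5)
  expand = solve-∀
  collect : ∀ a b → a * 3 + b * 3 + (2 * a + 5) + 2 * b ≡ (a + b + 1) * 5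
  collect = solve-∀

14≤4n+2 : ∀ {n} → 3 ≤ n → 14 ≤ 4 * n + 2
14≤4n+2 n≥3 = +-monoˡ-≤ 2 (*-monoʳ-≤ 4 n≥3)

-- The only place where 3 ≤ n is needed: a = 0 or 1 together with b = 1 is too small.
8≤3a+4b : ∀ {n} a b → 3 ≤ n → 1 ≤ b → 4 * n + 2 ≤ a * 7 + b * 6 → 8 ≤ 3 * a + 4 * b
8≤3a+4b a (suc (suc b)) _ _ _ = ≤-trans (*-monoʳ-≤ 4 (s≤s (s≤s (z≤n {b})))) (m≤n+m _ (3 * a))
8≤3a+4b (suc (suc a)) 1 _ _ _ = ≤-trans (m≤n+m 8 2) (+-monoˡ-≤ 4 (*-monoʳ-≤ 3 (s≤s (s≤s (z≤n {a})))))
8≤3a+4b 0 1 n≥3 _ small = ⊥-elim (1+n≰n (≤-trans (14≤4n+2 n≥3) (≤-trans small (m≤m+n 6 7))))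
8≤3a+4b 1 1 n≥3 _ small = ⊥-elim (1+n≰n (≤-trans (14≤4n+2 n≥3) small))

ceil5-2n<a+b : ∀ {n a b a′ b′} → 3 ≤ n → 1 ≤ b → a′ + a ≡ n → b′ + b ≡ n →
                        2 * (a′ + b′ + 1) ≤ a * 5 + b * 4 → ceil5 (2 * n) + 1 ≤ a + b
ceil5-2n<a+b {n} {a} {b} {a′} {b′} n≥3 b≥1 a′+a≡n b′+b≡n counted =
  ceil5-bound (2 * n) (a + b) (*-cancelˡ-≤ 2 (begin
    2 * (2 * n + 5)                      ≡⟨ double n ⟩
    4 * n + 2 + 8                        ≤⟨ +-mono-≤ 4n+2≤7a+6b (8≤3a+4b a b n≥3 b≥1 4n+2≤7a+6b) ⟩
    a * 7 + b * 6 + (3 * a + 4 * b)      ≡⟨ collect a b ⟩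
    2 * ((a + b) * 5)                    ∎))
  where
  open ≤-Reasoning
  double : ∀ m → 2 * (2 * m + 5) ≡ 4 * m + 2 + 8
  double = solve-∀
  collect : ∀ a b → a * 7 + b * 6 + (3 * a + 4 * b) ≡ 2 * ((a + b) * 5)
  collect = solve-∀
  4n+2≤7a+6b : 4 * n + 2 ≤ a * 7 + b * 6
  4n+2≤7a+6b = begin
    4 * n + 2                            ≡⟨ cong (_+ 2) (*-distribʳ-+ n 2 2) ⟩
    2 * n + 2 * n + 2                    ≡⟨ cong₂ (λ p q → 2 * p + 2 * q + 2) a′+a≡n b′+b≡n ⟨
    2 * (a′ + a) + 2 * (b′ + b) + 2      ≡⟨ shuffle a′ a b′ b ⟩
    2 * (a′ + b′ + 1) + 2 * (a + b)      ≤⟨ +-monoˡ-≤ (2 * (a + b)) counted ⟩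
    a * 5 + b * 4 + 2 * (a + b)          ≡⟨ gather a b ⟩
    a * 7 + b * 6                        ∎
    where
    shuffle : ∀ a′ a b′ b → 2 * (a′ + a) + 2 * (b′ + b) + 2 ≡ 2 * (a′ + b′ + 1) + 2 * (a + b)
    shuffle = solve-∀
    gather : ∀ a b → a * 5 + b * 4 + 2 * (a + b) ≡ a * 7 + b * 6
    gather = solve-∀

module MycielskiOfDegree≤2
  {n : ℕ} {A : Fin n → Fin n → Set} (A? : Decidable A) (A-sym : Symmetric A)
  (indegree≤2 : ∀ j → ∑[ i ∈ allFin n ] 𝟙 ⌊ A? i j ⌋ ≤ 2)
  (C : MV n → Bool) (isLD : IsLDSet (MAdj A) C)
  where

  outdegree≤2 : ∀ j → ∑[ i ∈ allFin n ] 𝟙 ⌊ A? j i ⌋ ≤ 2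
  outdegree≤2 j = ≤-trans (∑-mono (allFin n) λ i → 𝟙⌊⌋-mono (A? j i) (A? i j) A-sym) (indegree≤2 j)

  #v∈C #u∈C #v∉C #u∉C : ℕ
  #v∈C = ∑[ i ∈ allFin n ] 𝟙 (C (v i))
  #u∈C = ∑[ i ∈ allFin n ] 𝟙 (C (u i))
  #v∉C = ∑[ i ∈ allFin n ] 𝟙 (not (C (v i)))
  #u∉C = ∑[ i ∈ allFin n ] 𝟙 (not (C (u i)))

  complement : ∀ (g : Fin n → Bool) →
               (∑[ i ∈ allFin n ] 𝟙 (not (g i))) + (∑[ i ∈ allFin n ] 𝟙 (g i)) ≡ n
  complement g = trans (∑-complement (allFin n) g) (length-tabulate id)

  card-split : card C ≡ #v∈C + #u∈C + 𝟙 (C w)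
  card-split = ∑-MVerts {n} (λ x → 𝟙 (C x))

  bound-without-w : 3 ≤ n → C w ≡ false → ceil5 (2 * n) + 1 ≤ card C
  bound-without-w n≥3 w∉C = subst (ceil5 (2 * n) + 1 ≤_) (sym card≡)
    (ceil5-2n<a+b {n} {#v∈C} {#u∈C} {#v∉C} {#u∉C} n≥3 #u∈C≥1
      (complement (λ i → C (v i))) (complement (λ i → C (u i)))
      (subst₂ (λ l r → 2 * l ≤ r) outside-split budget-split (discharging B load≤B)))
    where
    open Discharging (MVerts n) (MVerts-unique n) (MVerts-complete n) (MAdj? A?) isLD (λ _ → true)

    B : MV n → ℕ
    B (v _) = 4
    B (u _) = 3
    B w     = 0

    load≤B : ∀ c → c ∈C C → load c ≤ B c
    load≤B (v j) _   = ≤-trans (load≤ (v j)) (≤-trans (≤-reflexive (∑-MVerts {n} _))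
                         (+-mono-≤ (+-mono-≤ (indegree≤2 j) (indegree≤2 j)) z≤n))
    load≤B (u j) _   = ≤-trans (load≤ (u j)) (≤-trans (≤-reflexive (∑-MVerts {n} _))
                         (+-mono-≤ (+-mono-≤ (outdegree≤2 j) (≤-reflexive (∑-zero (allFin n)))) ≤-refl))
    load≤B w     w∈C = contradiction (trans (sym w∉C) w∈C) λ ()

    outside-split : ∑ (MVerts n) outside ≡ #v∉C + #u∉C + 1
    outside-split = trans (∑-MVerts {n} outside) (cong (λ b → #v∉C + #u∉C + 𝟙 (not b)) w∉C)

    budget-split : ∑[ c ∈ MVerts n ] 𝟙 (C c) * (B c + B c ⊓ 1) ≡ #v∈C * 5 + #u∈C * 4
    budget-split = begin
      ∑[ c ∈ MVerts n ] 𝟙 (C c) * (B c + B c ⊓ 1)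
        ≡⟨ ∑-MVerts {n} (λ c → 𝟙 (C c) * (B c + B c ⊓ 1)) ⟩
      (∑[ i ∈ allFin n ] 𝟙 (C (v i)) * 5) + (∑[ i ∈ allFin n ] 𝟙 (C (u i)) * 4) + 𝟙 (C w) * 0
        ≡⟨ cong₂ (λ p q → p + q + 𝟙 (C w) * 0) (∑-*ʳ (allFin n) 5 _) (∑-*ʳ (allFin n) 4 _) ⟩
      #v∈C * 5 + #u∈C * 4 + 𝟙 (C w) * 0
        ≡⟨ cong (λ b → #v∈C * 5 + #u∈C * 4 + 𝟙 b * 0) w∉C ⟩
      #v∈C * 5 + #u∈C * 4 + 0
        ≡⟨ +-identityʳ _ ⟩
      #v∈C * 5 + #u∈C * 4 ∎
      where open ≡-Reasoning

    #u∈C≥1 : 1 ≤ #u∈C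
    #u∈C≥1 with proj₁ isLD w
    ... | w   , inj₁ refl , w∈C  = contradiction (trans (sym w∉C) w∈C) λ ()
    ... | u j , inj₂ _    , uj∈C =
      ≤-trans (1≤𝟙ᵗ uj∈C) (∑-≥ (allFin n) (λ i → 𝟙 (C (u i))) (∈-allFin j))
    ... | v _ , inj₂ ()   , _
    ... | w   , inj₂ ()   , _

    card≡ : card C ≡ #v∈C + #u∈C
    card≡ = trans card-split (trans (cong (λ b → #v∈C + #u∈C + 𝟙 b) w∉C) (+-identityʳ _))

  bound-with-w : C w ≡ true → ceil5 (2 * n) + 1 ≤ card C
  bound-with-w w∈C = subst (ceil5 (2 * n) + 1 ≤_) (sym card≡)
    (ceil5-2n≤a+b {n} {#v∈C} {#u∈C} {#v∉C} (complement (λ i → C (v i)))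
      (subst₂ (λ l r → 2 * l ≤ r) outside-split budget-split (discharging B load≤B)))
    where
    isV : MV n → Bool
    isV (v _) = true
    isV _     = false

    open Discharging (MVerts n) (MVerts-unique n) (MVerts-complete n) (MAdj? A?) isLD isV

    B : MV n → ℕ
    B (v _) = 2
    B (u _) = 2
    B w     = 0

    load≤B : ∀ c → c ∈C C → load c ≤ B c
    load≤B (v j) _ = ≤-trans (load≤ (v j)) (≤-trans (≤-reflexive (∑-MVerts {n} _))
                       (+-mono-≤ (+-mono-≤ (indegree≤2 j) (≤-reflexive (∑-zero (allFin n)))) z≤n))
    load≤B (u j) _ = ≤-trans (load≤ (u j)) (≤-trans (≤-reflexive (∑-MVerts {n} _))
                       (+-mono-≤ (+-mono-≤ (outdegree≤2 j) (≤-reflexive (∑-zero (allFin n)))) z≤n))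
    load≤B w     _ = ≤-trans (load≤ w) (≤-trans (≤-reflexive (∑-MVerts {n} _))
                       (+-mono-≤ (+-mono-≤ (≤-reflexive (∑-zero (allFin n)))
                                           (≤-reflexive (∑-zero (allFin n)))) z≤n))

    outside-split : ∑ (MVerts n) outside ≡ #v∉C
    outside-split = begin
      ∑ (MVerts n) outside                               ≡⟨ ∑-MVerts {n} outside ⟩
      #v∉C + (∑[ i ∈ allFin n ] 0) + 0                   ≡⟨ +-identityʳ _ ⟩
      #v∉C + (∑[ i ∈ allFin n ] 0)                       ≡⟨ cong (#v∉C +_) (∑-zero (allFin n)) ⟩
      #v∉C + 0                                           ≡⟨ +-identityʳ _ ⟩
      #v∉C                                               ∎
      where open ≡-Reasoning

    budget-split : ∑[ c ∈ MVerts n ] 𝟙 (C c) * (B c + B c ⊓ 1) ≡ #v∈C * 3 + #u∈C * 3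
    budget-split = begin
      ∑[ c ∈ MVerts n ] 𝟙 (C c) * (B c + B c ⊓ 1)
        ≡⟨ ∑-MVerts {n} (λ c → 𝟙 (C c) * (B c + B c ⊓ 1)) ⟩
      (∑[ i ∈ allFin n ] 𝟙 (C (v i)) * 3) + (∑[ i ∈ allFin n ] 𝟙 (C (u i)) * 3) + 𝟙 (C w) * 0
        ≡⟨ cong₂ (λ p q → p + q + 𝟙 (C w) * 0) (∑-*ʳ (allFin n) 3 _) (∑-*ʳ (allFin n) 3 _) ⟩
      #v∈C * 3 + #u∈C * 3 + 𝟙 (C w) * 0
        ≡⟨ cong (λ b → #v∈C * 3 + #u∈C * 3 + 𝟙 b * 0) w∈C ⟩
      #v∈C * 3 + #u∈C * 3 + 0
        ≡⟨ +-identityʳ _ ⟩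
      #v∈C * 3 + #u∈C * 3 ∎
      where open ≡-Reasoning

    card≡ : card C ≡ #v∈C + #u∈C + 1
    card≡ = trans card-split (cong (λ b → #v∈C + #u∈C + 𝟙 b) w∈C)

  ld-bound : 3 ≤ n → ceil5 (2 * n) + 1 ≤ card C
  ld-bound n≥3 with C w in w∈C
  ... | true  = bound-with-w w∈C
  ... | false = bound-without-w n≥3 w∈C

∑-toℕ≡ : ∀ {n} p → ∑[ i ∈ allFin n ] 𝟙 ⌊ toℕ i ≟ p ⌋ ≤ 1
∑-toℕ≡ {n} p = ∑-≤1 (allFin n) (allFin⁺ n) (λ i → 𝟙≤1 ⌊ toℕ i ≟ p ⌋) no-two
  where
  no-two : ∀ {i j} → i ≢ j → 1 ≤ 𝟙 ⌊ toℕ i ≟ p ⌋ → 1 ≤ 𝟙 ⌊ toℕ j ≟ p ⌋ → ⊥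
  no-two {i} {j} i≢j i≡p j≡p = i≢j (toℕ-injective
    (trans (toWitness {a? = toℕ i ≟ p} (1≤𝟙⁻ i≡p)) (sym (toWitness {a? = toℕ j ≟ p} (1≤𝟙⁻ j≡p)))))

indegree≤2 : ∀ {n} {A : Fin n → Fin n → Set} (A? : Decidable A) {j} p q →
             (∀ {i} → A i j → toℕ i ≡ p ⊎ toℕ i ≡ q) → ∑[ i ∈ allFin n ] 𝟙 ⌊ A? i j ⌋ ≤ 2
indegree≤2 {n} A? {j} p q candidates = begin
  ∑[ i ∈ allFin n ] 𝟙 ⌊ A? i j ⌋
    ≤⟨ ∑-mono (allFin n) pointwise ⟩
  ∑[ i ∈ allFin n ] (𝟙 ⌊ toℕ i ≟ p ⌋ + 𝟙 ⌊ toℕ i ≟ q ⌋)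
    ≡⟨ ∑-+ (allFin n) _ _ ⟩
  (∑[ i ∈ allFin n ] 𝟙 ⌊ toℕ i ≟ p ⌋) + (∑[ i ∈ allFin n ] 𝟙 ⌊ toℕ i ≟ q ⌋)
    ≤⟨ +-mono-≤ (∑-toℕ≡ {n} p) (∑-toℕ≡ {n} q) ⟩
  2 ∎
  where
  open ≤-Reasoning
  pointwise : ∀ i → 𝟙 ⌊ A? i j ⌋ ≤ 𝟙 ⌊ toℕ i ≟ p ⌋ + 𝟙 ⌊ toℕ i ≟ q ⌋
  pointwise i with A? i j
  ... | no  _ = z≤n
  ... | yes i~j with candidates i~j
  ...   | inj₁ i≡p = ≤-trans (1≤𝟙 (fromWitness {a? = toℕ i ≟ p} i≡p)) (m≤m+n _ _)
  ...   | inj₂ i≡q = ≤-trans (1≤𝟙 (fromWitness {a? = toℕ i ≟ q} i≡q)) (m≤n+m _ _)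

PathAdj? : ∀ n → Decidable (PathAdj n)
PathAdj? n i j = (suc (toℕ i) ≟ toℕ j) ⊎-dec (suc (toℕ j) ≟ toℕ i)

CycleAdj? : ∀ n → Decidable (CycleAdj n)
CycleAdj? n i j = PathAdj? n i j ⊎-dec (((toℕ i ≟ 0) ×-dec (suc (toℕ j) ≟ n))
                                       ⊎-dec ((toℕ j ≟ 0) ×-dec (suc (toℕ i) ≟ n)))

PathAdj-sym : ∀ n → Symmetric (PathAdj n)
PathAdj-sym n (inj₁ i+1≡j) = inj₂ i+1≡j
PathAdj-sym n (inj₂ j+1≡i) = inj₁ j+1≡i

CycleAdj-sym : ∀ n → Symmetric (CycleAdj n)
CycleAdj-sym n (inj₁ i~j)          = inj₁ (PathAdj-sym n i~j)
CycleAdj-sym n (inj₂ (inj₁ wrap))  = inj₂ (inj₂ wrap)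
CycleAdj-sym n (inj₂ (inj₂ wrap))  = inj₂ (inj₁ wrap)

PathAdj-candidates : ∀ n {i j : Fin n} → PathAdj n i j → toℕ i ≡ suc (toℕ j) ⊎ toℕ i ≡ toℕ j ∸ 1
PathAdj-candidates n (inj₁ i+1≡j) = inj₂ (cong (_∸ 1) i+1≡j)
PathAdj-candidates n (inj₂ j+1≡i) = inj₁ (sym j+1≡i)

cycle-succ cycle-pred : ℕ → ℕ → ℕ
cycle-succ n j = if suc j ≡ᵇ n then 0 else suc j
cycle-pred n j = if j ≡ᵇ 0 then n ∸ 1 else j ∸ 1

cycle-candidates : ∀ n i j → i < n →
  ((suc i ≡ j) ⊎ (suc j ≡ i)) ⊎ ((i ≡ 0 × suc j ≡ n) ⊎ (j ≡ 0 × suc i ≡ n)) →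
  i ≡ cycle-succ n j ⊎ i ≡ cycle-pred n j
cycle-candidates n i .(suc i) _ (inj₁ (inj₁ refl)) = inj₂ refl
cycle-candidates n .(suc j) j i<n (inj₁ (inj₂ refl)) with suc j ≡ᵇ n in j+1≟n
... | false = inj₁ refl
... | true  = contradiction (≡ᵇ⇒≡ (suc j) n (subst T (sym j+1≟n) tt)) (<⇒≢ i<n)
cycle-candidates .(suc j) .0 j _ (inj₂ (inj₁ (refl , refl))) with suc j ≡ᵇ suc j in j+1≟j+1
... | true  = inj₁ refl
... | false = contradiction (≡⇒≡ᵇ (suc j) (suc j) refl) (subst T j+1≟j+1)
cycle-candidates .(suc i) i .0 _ (inj₂ (inj₂ (refl , refl))) = inj₂ refl

BaseAdj? : ∀ k n → Decidable (BaseAdj k n)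
BaseAdj? path  n = PathAdj? n
BaseAdj? cycle n = CycleAdj? n

BaseAdj-sym : ∀ k n → Symmetric (BaseAdj k n)
BaseAdj-sym path  n = PathAdj-sym n
BaseAdj-sym cycle n = CycleAdj-sym n

BaseAdj-indegree≤2 : ∀ k n j → ∑[ i ∈ allFin n ] 𝟙 ⌊ BaseAdj? k n i j ⌋ ≤ 2
BaseAdj-indegree≤2 path  n j = indegree≤2 (PathAdj? n) _ _ (PathAdj-candidates n)
BaseAdj-indegree≤2 cycle n j =
  indegree≤2 (CycleAdj? n) _ _ λ {i} i~j → cycle-candidates n (toℕ i) (toℕ j) (toℕ<n i) i~j

corollary1 : (n : ℕ) → 3 ≤ n → (k : Kind) → (C : MV n → Bool) →
    IsLDSet (MAdj (BaseAdj k n)) C → ceil5 (2 * n) + 1 ≤ card C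
corollary1 n n≥3 k C isLD =
  MycielskiOfDegree≤2.ld-bound (BaseAdj? k n) (BaseAdj-sym k n) (BaseAdj-indegree≤2 k n) C isLD n≥3
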